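{- Let $\mathcal{C}$ be a category with an $(\mathcal{E},\mathcal{M})$-factorization system, $I$ an object, and $F\colon\mathcal{C}\to\mathcal{C}$ a functor that preserves $\mathcal{M}$ and admits precise factorizations w.r.t. $\mathcal{M}$, and assume countable coproducts exist in $\mathcal{C}$. A pointed $F$-coalgebra $(C,c,i_C)$ is $\mathcal{M}$-reachable iff it is isomorphic (as a pointed coalgebra) to the pointed coalgebra $(R,r,i_R)$ constructed from $(C,c,i_C)$ as follows: factor $i_C=m_0\cdot i_C'$ with $i_C'\colon I\to C_0$ in $\mathcal{E}$, $m_0\in\mathcal{M}$; for each $k\in\mathbb{N}$ let $c\cdot m_k=Fm_{k+1}\cdot c_k$ be a precise factorization ($m_{k+1}\colon C_{k+1}\to C$ in $\mathcal{M}$, $c_k\colon C_k\to FC_{k+1}$ $F$-precise); give $\coprod_kC_k$ the structure $\gamma=[F\mathsf{in}_{k+1}]_k\cdot\coprod_kc_k$; factor $[m_k]_k=m'\cdot e$ with $e\colon\coprod_kC_k\to R$ in $\mathcal{E}$, $m'\in\mathcal{M}$; let $r\colon R\to FR$ be the unique morphism with $r\cdot e=Fe\cdot\gamma$ and $Fm'\cdot r=c\cdot m'$; and let $i_R=e\cdot\mathsf{in}_0\cdot i_C'$.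
   Context: An $(\mathcal{E},\mathcal{M})$-factorization system: classes $\mathcal{E},\mathcal{M}$ closed under composition, containing all isomorphisms, every morphism factors as $m\cdot e$ ($e\in\mathcal{E}$, $m\in\mathcal{M}$), with unique diagonal fill-ins for commutative squares $g\cdot e=m\cdot f$; $\mathcal{M}$ need not consist of monomorphisms. $F$ preserves $\mathcal{M}$ if $Fm\in\mathcal{M}$ for $m\in\mathcal{M}$. A morphism $p\colon P\to FR$ is $F$-precise (w.r.t. $\mathcal{M}$) if for all $f\colon P\to FC'$ and $m\colon R\to D$, $h\colon C'\to D$ in $\mathcal{M}$ with $Fm\cdot p=Fh\cdot f$ there is $d\colon R\to C'$ with $Fd\cdot p=f$ and $h\cdot d=m$. $F$ admits precise factorizations if every $f\colon S\to FY$ equals $Fh\cdot p$ for some $h\in\mathcal{M}$ and $F$-precise $p$. A pointed $F$-coalgebra is $(C,c,i_C)$ with $c\colon C\to FC$, $i_C\colon I\to C$; pointed coalgebra morphisms $h$ satisfy $d\cdot h=Fh\cdot c$ and preserve points. A split epimorphism of pointed coalgebras is a pointed coalgebra morphism $h$ with a pointed coalgebra morphism $s$, $h\cdot s=\mathrm{id}$. A pointed coalgebra is $\mathcal{M}$-reachable if every pointed coalgebra morphism into it whose underlying morphism is in $\mathcal{M}$ is a split epimorphism of pointed coalgebras. -}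

module Defs where

open import Level using (Level; _⊔_) renaming (suc to lsuc)
open import Data.Nat using (ℕ; zero; suc)
open import Data.Product using (Σ; Σ-syntax; _×_; _,_)
open import Relation.Binary using (Rel; IsEquivalence)
open import Function.Bundles using (_⇔_)

record Category (o ℓ e : Level) : Set (lsuc (o ⊔ ℓ ⊔ e)) where
  infixr 9 _∘_
  infix 4 _≈_
  infix 4 _⇒_
  field
    Obj : Set o
    _⇒_ : Obj → Obj → Set ℓ
    _≈_ : ∀ {A B} → Rel (A ⇒ B) e
    id  : ∀ {A} → A ⇒ A
    _∘_ : ∀ {A B C} → B ⇒ C → A ⇒ B → A ⇒ C
    equiv     : ∀ {A B} → IsEquivalence (_≈_ {A} {B})
    assoc     : ∀ {A B C D} {f : A ⇒ B} {g : B ⇒ C} {h : C ⇒ D} →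
                (h ∘ g) ∘ f ≈ h ∘ (g ∘ f)
    identityˡ : ∀ {A B} {f : A ⇒ B} → id ∘ f ≈ f
    identityʳ : ∀ {A B} {f : A ⇒ B} → f ∘ id ≈ f
    ∘-resp-≈  : ∀ {A B C} {f h : B ⇒ C} {g i : A ⇒ B} →
                f ≈ h → g ≈ i → f ∘ g ≈ h ∘ i

module _ {o ℓ e : Level} (𝒞 : Category o ℓ e) where
  open Category 𝒞

  record Endofunctor : Set (o ⊔ ℓ ⊔ e) where
    field
      F₀ : Obj → Obj
      F₁ : ∀ {A B} → A ⇒ B → F₀ A ⇒ F₀ B
      identity     : ∀ {A} → F₁ (id {A}) ≈ id
      homomorphism : ∀ {A B C} {f : A ⇒ B} {g : B ⇒ C} →
                     F₁ (g ∘ f) ≈ F₁ g ∘ F₁ f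
      F-resp-≈     : ∀ {A B} {f g : A ⇒ B} → f ≈ g → F₁ f ≈ F₁ g

  record IsIso {A B : Obj} (f : A ⇒ B) : Set (ℓ ⊔ e) where
    field
      inv  : B ⇒ A
      isoˡ : inv ∘ f ≈ id
      isoʳ : f ∘ inv ≈ id

  -- (E,M)-factorization system; E and M are classes of morphisms,
  -- hence closed under the hom-equality ≈.
  record FactorizationSystem (p : Level) : Set (o ⊔ ℓ ⊔ e ⊔ lsuc p) where
    field
      E : ∀ {A B} → A ⇒ B → Set p
      M : ∀ {A B} → A ⇒ B → Set p
      E-resp-≈ : ∀ {A B} {f g : A ⇒ B} → f ≈ g → E f → E g
      M-resp-≈ : ∀ {A B} {f g : A ⇒ B} → f ≈ g → M f → M g
      E-∘ : ∀ {A B C} {f : A ⇒ B} {g : B ⇒ C} → E f → E g → E (g ∘ f)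
      M-∘ : ∀ {A B C} {f : A ⇒ B} {g : B ⇒ C} → M f → M g → M (g ∘ f)
      iso⇒E : ∀ {A B} {f : A ⇒ B} → IsIso f → E f
      iso⇒M : ∀ {A B} {f : A ⇒ B} → IsIso f → M f
      factor : ∀ {A B} (f : A ⇒ B) →
               Σ[ X ∈ Obj ] Σ[ ε ∈ A ⇒ X ] Σ[ μ ∈ X ⇒ B ]
                 (E ε × M μ × f ≈ μ ∘ ε)
      diagonal : ∀ {A B C D} {ε : A ⇒ B} {μ : C ⇒ D} {f : A ⇒ C} {g : B ⇒ D} →
                 E ε → M μ → g ∘ ε ≈ μ ∘ f →
                 Σ[ d ∈ B ⇒ C ] ((d ∘ ε ≈ f × μ ∘ d ≈ g) ×
                   (∀ (d' : B ⇒ C) → d' ∘ ε ≈ f → μ ∘ d' ≈ g → d' ≈ d))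

  record CountableCoproducts : Set (o ⊔ ℓ ⊔ e) where
    field
      ∐    : (ℕ → Obj) → Obj
      inj  : ∀ (A : ℕ → Obj) (k : ℕ) → A k ⇒ ∐ A
      [_]  : ∀ {A : ℕ → Obj} {X : Obj} → (∀ k → A k ⇒ X) → ∐ A ⇒ X
      commute : ∀ {A : ℕ → Obj} {X : Obj} (f : ∀ k → A k ⇒ X) (k : ℕ) →
                [ f ] ∘ inj A k ≈ f k
      unique  : ∀ {A : ℕ → Obj} {X : Obj} (f : ∀ k → A k ⇒ X) (u : ∐ A ⇒ X) →
                (∀ k → u ∘ inj A k ≈ f k) → u ≈ [ f ]

    ∐-map : ∀ {A B : ℕ → Obj} → (∀ k → A k ⇒ B k) → ∐ A ⇒ ∐ B
    ∐-map {A} {B} f = [ (λ k → inj B k ∘ f k) ]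

module _ {o ℓ e p : Level} {𝒞 : Category o ℓ e}
         (FS : FactorizationSystem 𝒞 p) (F : Endofunctor 𝒞) where
  open Category 𝒞
  open FactorizationSystem FS
  open Endofunctor F

  PreservesM : Set (o ⊔ ℓ ⊔ p)
  PreservesM = ∀ {A B} {m : A ⇒ B} → M m → M (F₁ m)

  Precise : ∀ {P R : Obj} → P ⇒ F₀ R → Set (o ⊔ ℓ ⊔ e ⊔ p)
  Precise {P} {R} q =
    ∀ {C' D : Obj} (f : P ⇒ F₀ C') (m : R ⇒ D) (h : C' ⇒ D) →
      M m → M h → F₁ m ∘ q ≈ F₁ h ∘ f →
      Σ[ d ∈ R ⇒ C' ] (F₁ d ∘ q ≈ f × h ∘ d ≈ m)

  AdmitsPreciseFactorizations : Set (o ⊔ ℓ ⊔ e ⊔ p)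
  AdmitsPreciseFactorizations =
    ∀ {S Y : Obj} (f : S ⇒ F₀ Y) →
      Σ[ Y' ∈ Obj ] Σ[ h ∈ Y' ⇒ Y ] Σ[ q ∈ S ⇒ F₀ Y' ]
        (M h × Precise q × f ≈ F₁ h ∘ q)

module _ {o ℓ e : Level} {𝒞 : Category o ℓ e} (F : Endofunctor 𝒞)
         (I : Category.Obj 𝒞) where
  open Category 𝒞
  open Endofunctor F

  record PointedCoalgebra : Set (o ⊔ ℓ) where
    constructor pointedCoalgebra
    field
      carrier   : Obj
      structure : carrier ⇒ F₀ carrier
      point     : I ⇒ carrier

  open PointedCoalgebra

  record PCMorphism (A B : PointedCoalgebra) : Set (ℓ ⊔ e) where
    field
      hom       : carrier A ⇒ carrier B
      commutes  : structure B ∘ hom ≈ F₁ hom ∘ structure A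
      preserves : hom ∘ point A ≈ point B

  open PCMorphism

  IsSplitEpi : ∀ {A B} → PCMorphism A B → Set (ℓ ⊔ e)
  IsSplitEpi {A} {B} h = Σ[ s ∈ PCMorphism B A ] (hom h ∘ hom s ≈ id)

  PCIsomorphic : PointedCoalgebra → PointedCoalgebra → Set (ℓ ⊔ e)
  PCIsomorphic A B = Σ[ h ∈ PCMorphism A B ] Σ[ g ∈ PCMorphism B A ]
                       (hom g ∘ hom h ≈ id × hom h ∘ hom g ≈ id)

module _ {o ℓ e p : Level} {𝒞 : Category o ℓ e}
         (FS : FactorizationSystem 𝒞 p) (F : Endofunctor 𝒞)
         (I : Category.Obj 𝒞) where
  open Category 𝒞
  open FactorizationSystem FS
  open PCMorphism

  Reachable : PointedCoalgebra F I → Set (o ⊔ ℓ ⊔ e ⊔ p)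
  Reachable C = ∀ (D : PointedCoalgebra F I) (h : PCMorphism F I D C) →
                  M (hom h) → IsSplitEpi F I h

module _ {o ℓ e p : Level} {𝒞 : Category o ℓ e}
         (FS : FactorizationSystem 𝒞 p) (F : Endofunctor 𝒞)
         (I : Category.Obj 𝒞) (CP : CountableCoproducts 𝒞) where
  open Category 𝒞
  open FactorizationSystem FS
  open Endofunctor F
  open CountableCoproducts CP

  -- All the (arbitrarily chosen) data of the construction of (R, r, i_R)
  -- from a pointed coalgebra (C, c, i_C), with the equations it must satisfy.
  record Construction (Cc : PointedCoalgebra F I) : Set (o ⊔ ℓ ⊔ e ⊔ p) where
    open PointedCoalgebra Cc renaming (carrier to C; structure to c; point to i)
    field
      Cs : ℕ → Obj
      m  : ∀ k → Cs k ⇒ C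
      m∈M : ∀ k → M (m k)
      i'   : I ⇒ Cs 0
      i'∈E : E i'
      i-factor : i ≈ m 0 ∘ i'
      cs : ∀ k → Cs k ⇒ F₀ (Cs (suc k))
      cs-precise : ∀ k → Precise FS F (cs k)
      cs-factor  : ∀ k → c ∘ m k ≈ F₁ (m (suc k)) ∘ cs k
    γ : ∐ Cs ⇒ F₀ (∐ Cs)
    γ = [ (λ k → F₁ (inj Cs (suc k))) ] ∘ ∐-map cs
    field
      R    : Obj
      e'   : ∐ Cs ⇒ R
      e'∈E : E e'
      m'   : R ⇒ C
      m'∈M : M m'
      copair-factor : [ m ] ≈ m' ∘ e'
      r : R ⇒ F₀ R
      r-e  : r ∘ e' ≈ F₁ e' ∘ γ
      r-m' : F₁ m' ∘ r ≈ c ∘ m'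
    iR : I ⇒ R
    iR = e' ∘ (inj Cs 0 ∘ i')

    coalgebra : PointedCoalgebra F I
    coalgebra = pointedCoalgebra R r iR

-- The constructed coalgebra R is itself M-reachable. Given a pointed coalgebra
-- morphism h : D → R in M, preciseness of the c_k lets one lift the maps
-- e·in_k : C_k → R through h stage by stage, compatibly with the structures;
-- the copairing of the lifts is a coalgebra morphism, and its diagonal fill-in
-- against e and h is a coalgebra morphism splitting h (this uses F h ∈ M).
-- Since reachability is invariant under isomorphism, C ≅ R implies C reachable.
-- Conversely, if C is reachable then m' : R → C splits by some s; s lies in M
-- by left cancellation, so s splits as R is reachable, and m' is an isomorphism.

{-# OPTIONS --safe #-}
module Submission where

open import Level using (Level; _⊔_)
open import Data.Nat using (ℕ; zero; suc)
open import Data.Product using (Σ-syntax; _×_; _,_; proj₁; proj₂)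
open import Function.Bundles using (_⇔_; mk⇔)
open import Relation.Binary using (Setoid; IsEquivalence)
import Relation.Binary.Reasoning.Setoid as SetoidReasoning

open import Defs

module CategoryProperties {o ℓ e : Level} (𝒞 : Category o ℓ e) where
  open Category 𝒞

  private variable
    A B : Obj
    f g h i k : A ⇒ B

  module ≈ {A B : Obj} = IsEquivalence (equiv {A} {B})

  hom-setoid : Obj → Obj → Setoid ℓ e
  hom-setoid A B = record { Carrier = A ⇒ B ; _≈_ = _≈_ ; isEquivalence = equiv }

  module HomReasoning {A B : Obj} = SetoidReasoning (hom-setoid A B)

  infixr 4 _⟩∘⟨_ refl⟩∘⟨_
  infixl 5 _⟩∘⟨refl

  _⟩∘⟨_ : f ≈ h → g ≈ i → f ∘ g ≈ h ∘ i
  _⟩∘⟨_ = ∘-resp-≈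

  refl⟩∘⟨_ : g ≈ i → f ∘ g ≈ f ∘ i
  refl⟩∘⟨ p = ≈.refl ⟩∘⟨ p

  _⟩∘⟨refl : f ≈ h → f ∘ g ≈ h ∘ g
  p ⟩∘⟨refl = p ⟩∘⟨ ≈.refl

  pullʳ : f ∘ g ≈ h → (k ∘ f) ∘ g ≈ k ∘ h
  pullʳ p = ≈.trans assoc (refl⟩∘⟨ p)

  pullˡ : f ∘ g ≈ h → f ∘ (g ∘ k) ≈ h ∘ k
  pullˡ p = ≈.trans (≈.sym assoc) (p ⟩∘⟨refl)

  id-isIso : IsIso 𝒞 (id {A})
  id-isIso = record { inv = id ; isoˡ = identityˡ ; isoʳ = identityˡ }

  retraction∘section≈id⇒inverse : {s : A ⇒ B} {r t : B ⇒ A} →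
                                  r ∘ s ≈ id → s ∘ t ≈ id → s ∘ r ≈ id
  retraction∘section≈id⇒inverse {s = s} {r = r} {t = t} r∘s s∘t = begin
    s ∘ r              ≈⟨ identityʳ ⟨
    (s ∘ r) ∘ id       ≈⟨ refl⟩∘⟨ s∘t ⟨
    (s ∘ r) ∘ (s ∘ t)  ≈⟨ pullʳ (pullˡ r∘s) ⟩
    s ∘ (id ∘ t)       ≈⟨ refl⟩∘⟨ identityˡ ⟩
    s ∘ t              ≈⟨ s∘t ⟩
    id                 ∎
    where open HomReasoning

module CoproductProperties {o ℓ e : Level} {𝒞 : Category o ℓ e}
                           (CP : CountableCoproducts 𝒞) where
  open Category 𝒞
  open CategoryProperties 𝒞
  open CountableCoproducts CP

  ∐-ext : ∀ {A : ℕ → Obj} {X : Obj} {u v : ∐ A ⇒ X} →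
          (∀ k → u ∘ inj A k ≈ v ∘ inj A k) → u ≈ v
  ∐-ext {v = v} p = ≈.trans (unique _ _ p) (≈.sym (unique _ v (λ _ → ≈.refl)))

module FactorizationProperties {o ℓ e p : Level} {𝒞 : Category o ℓ e}
                               (FS : FactorizationSystem 𝒞 p) where
  open Category 𝒞
  open CategoryProperties 𝒞
  open FactorizationSystem FS

  private variable
    A B C D : Obj

  fill-in : {ε : A ⇒ B} {μ : C ⇒ D} {f : A ⇒ C} {g : B ⇒ D} →
            E ε → M μ → g ∘ ε ≈ μ ∘ f →
            Σ[ d ∈ B ⇒ C ] (d ∘ ε ≈ f × μ ∘ d ≈ g)
  fill-in ε∈E μ∈M square = let (d , triangles , _) = diagonal ε∈E μ∈M square in d , triangles

  diagonal-unique : {ε : A ⇒ B} {μ : C ⇒ D} {d₁ d₂ : B ⇒ C} → E ε → M μ →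
                    d₁ ∘ ε ≈ d₂ ∘ ε → μ ∘ d₁ ≈ μ ∘ d₂ → d₁ ≈ d₂
  diagonal-unique {d₁ = d₁} {d₂} ε∈E μ∈M d₁ε≈d₂ε μd₁≈μd₂ =
    let (_ , _ , unique) = diagonal ε∈E μ∈M assoc
    in ≈.trans (unique d₁ d₁ε≈d₂ε μd₁≈μd₂) (≈.sym (unique d₂ ≈.refl ≈.refl))

  M-cancelˡ : {f : A ⇒ B} {g : B ⇒ C} → M g → M (g ∘ f) → M f
  M-cancelˡ {A} {f = f} {g} g∈M gf∈M with factor f
  ... | X , ε , μ , ε∈E , μ∈M , f≈με = M-resp-≈ (≈.sym f≈με) (M-∘ (iso⇒M ε-isIso) μ∈M)
    where
      open HomReasoning

      retraction : Σ[ d ∈ X ⇒ A ] (d ∘ ε ≈ id × (g ∘ f) ∘ d ≈ g ∘ μ)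
      retraction = fill-in ε∈E gf∈M (begin
        (g ∘ μ) ∘ ε  ≈⟨ pullʳ (≈.sym f≈με) ⟩
        g ∘ f        ≈⟨ identityʳ ⟨
        (g ∘ f) ∘ id ∎)

      d : X ⇒ A
      d = proj₁ retraction

      ε∘d≈id : ε ∘ d ≈ id
      ε∘d≈id = diagonal-unique ε∈E (M-∘ μ∈M g∈M)
        (begin
          (ε ∘ d) ∘ ε  ≈⟨ pullʳ (proj₁ (proj₂ retraction)) ⟩
          ε ∘ id       ≈⟨ identityʳ ⟩
          ε            ≈⟨ identityˡ ⟨
          id ∘ ε       ∎)
        (begin
          (g ∘ μ) ∘ (ε ∘ d)  ≈⟨ pullʳ (pullˡ (≈.sym f≈με)) ⟩
          g ∘ (f ∘ d)        ≈⟨ assoc ⟨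
          (g ∘ f) ∘ d        ≈⟨ proj₂ (proj₂ retraction) ⟩
          g ∘ μ              ≈⟨ identityʳ ⟨
          (g ∘ μ) ∘ id       ∎)

      ε-isIso : IsIso 𝒞 ε
      ε-isIso = record { inv = d ; isoˡ = proj₁ (proj₂ retraction) ; isoʳ = ε∘d≈id }

module CoalgebraProperties {o ℓ e p : Level} {𝒞 : Category o ℓ e}
                           (FS : FactorizationSystem 𝒞 p) (F : Endofunctor 𝒞) where
  open Category 𝒞
  open CategoryProperties 𝒞
  open FactorizationSystem FS
  open FactorizationProperties FS
  open Endofunctor F

  private variable
    A B C D : Obj

  IsCoalgebraHom : A ⇒ F₀ A → B ⇒ F₀ B → A ⇒ B → Set e
  IsCoalgebraHom α β h = β ∘ h ≈ F₁ h ∘ α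

  IsCoalgebraHom-id : {α : A ⇒ F₀ A} → IsCoalgebraHom α α id
  IsCoalgebraHom-id {α = α} = begin
    α ∘ id       ≈⟨ identityʳ ⟩
    α            ≈⟨ identityˡ ⟨
    id ∘ α       ≈⟨ identity ⟩∘⟨refl ⟨
    F₁ id ∘ α    ∎
    where open HomReasoning

  IsCoalgebraHom-∘ : {α : A ⇒ F₀ A} {β : B ⇒ F₀ B} {γ : C ⇒ F₀ C}
                     {f : A ⇒ B} {g : B ⇒ C} →
                     IsCoalgebraHom β γ g → IsCoalgebraHom α β f →
                     IsCoalgebraHom α γ (g ∘ f)
  IsCoalgebraHom-∘ {α = α} {β} {γ} {f} {g} g-hom f-hom = begin
    γ ∘ (g ∘ f)          ≈⟨ pullˡ g-hom ⟩
    (F₁ g ∘ β) ∘ f       ≈⟨ pullʳ f-hom ⟩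
    F₁ g ∘ (F₁ f ∘ α)    ≈⟨ pullˡ (≈.sym homomorphism) ⟩
    F₁ (g ∘ f) ∘ α       ∎
    where open HomReasoning

  diagonal-isCoalgebraHom :
    {α : A ⇒ F₀ A} {β : B ⇒ F₀ B} {γ : C ⇒ F₀ C} {δ : D ⇒ F₀ D}
    {ε : A ⇒ B} {μ : C ⇒ D} {f : A ⇒ C} {g : B ⇒ D} {d : B ⇒ C} →
    E ε → M (F₁ μ) →
    IsCoalgebraHom α β ε → IsCoalgebraHom γ δ μ →
    IsCoalgebraHom α γ f → IsCoalgebraHom β δ g →
    d ∘ ε ≈ f → μ ∘ d ≈ g → IsCoalgebraHom β γ d
  diagonal-isCoalgebraHom {α = α} {β} {γ} {δ} {ε} {μ} {f} {g} {d}
                          ε∈E Fμ∈M ε-hom μ-hom f-hom g-hom d∘ε≈f μ∘d≈g =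
    diagonal-unique ε∈E Fμ∈M
      (begin
        (γ ∘ d) ∘ ε          ≈⟨ pullʳ d∘ε≈f ⟩
        γ ∘ f                ≈⟨ f-hom ⟩
        F₁ f ∘ α             ≈⟨ F-resp-≈ d∘ε≈f ⟩∘⟨refl ⟨
        F₁ (d ∘ ε) ∘ α       ≈⟨ homomorphism ⟩∘⟨refl ⟩
        (F₁ d ∘ F₁ ε) ∘ α    ≈⟨ pullʳ (≈.sym ε-hom) ⟩
        F₁ d ∘ (β ∘ ε)       ≈⟨ assoc ⟨
        (F₁ d ∘ β) ∘ ε       ∎)
      (begin
        F₁ μ ∘ (γ ∘ d)       ≈⟨ assoc ⟨
        (F₁ μ ∘ γ) ∘ d       ≈⟨ pullˡ μ-hom ⟨
        δ ∘ (μ ∘ d)          ≈⟨ refl⟩∘⟨ μ∘d≈g ⟩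
        δ ∘ g                ≈⟨ g-hom ⟩
        F₁ g ∘ β             ≈⟨ F-resp-≈ μ∘d≈g ⟩∘⟨refl ⟨
        F₁ (μ ∘ d) ∘ β       ≈⟨ pullˡ (≈.sym homomorphism) ⟨
        F₁ μ ∘ (F₁ d ∘ β)    ∎)
    where open HomReasoning

module ReachabilityProperties {o ℓ e p : Level} {𝒞 : Category o ℓ e}
                              (FS : FactorizationSystem 𝒞 p) (F : Endofunctor 𝒞)
                              (I : Category.Obj 𝒞) where
  open Category 𝒞
  open CategoryProperties 𝒞
  open FactorizationSystem FS
  open FactorizationProperties FS
  open CoalgebraProperties FS F
  open PCMorphism

  private variable
    A B C : PointedCoalgebra F I

  infixr 9 _∘ᴾ_
  _∘ᴾ_ : PCMorphism F I B C → PCMorphism F I A B → PCMorphism F I A C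
  h ∘ᴾ k = record
    { hom       = hom h ∘ hom k
    ; commutes  = IsCoalgebraHom-∘ (commutes h) (commutes k)
    ; preserves = ≈.trans (pullʳ (preserves k)) (preserves h)
    }

  Reachable-resp-PCIsomorphic : PCIsomorphic F I A B → Reachable FS F I B →
                                Reachable FS F I A
  Reachable-resp-PCIsomorphic {B = B} (h , g , g∘h≈id , h∘g≈id) B-reachable D k k∈M =
    σ ∘ᴾ h , (begin
      hom k ∘ (hom σ ∘ hom h)  ≈⟨ assoc ⟨
      (hom k ∘ hom σ) ∘ hom h  ≈⟨ k∘σ≈g ⟩∘⟨refl ⟩
      hom g ∘ hom h            ≈⟨ g∘h≈id ⟩
      id                       ∎)
    where
      open HomReasoning

      h-isIso : IsIso 𝒞 (hom h)
      h-isIso = record { inv = hom g ; isoˡ = g∘h≈id ; isoʳ = h∘g≈id }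

      split : IsSplitEpi F I (h ∘ᴾ k)
      split = B-reachable D (h ∘ᴾ k) (M-∘ k∈M (iso⇒M h-isIso))

      σ : PCMorphism F I B D
      σ = proj₁ split

      k∘σ≈g : hom k ∘ hom σ ≈ hom g
      k∘σ≈g = begin
        hom k ∘ hom σ                      ≈⟨ identityˡ ⟨
        id ∘ (hom k ∘ hom σ)               ≈⟨ g∘h≈id ⟩∘⟨refl ⟨
        (hom g ∘ hom h) ∘ (hom k ∘ hom σ)  ≈⟨ pullʳ (≈.sym assoc) ⟩
        hom g ∘ ((hom h ∘ hom k) ∘ hom σ)  ≈⟨ refl⟩∘⟨ proj₂ split ⟩
        hom g ∘ id                         ≈⟨ identityʳ ⟩
        hom g                              ∎

  M-morphism-of-Reachable⇒PCIsomorphic :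
    Reachable FS F I B → Reachable FS F I A →
    (m : PCMorphism F I A B) → M (hom m) → PCIsomorphic F I B A
  M-morphism-of-Reachable⇒PCIsomorphic {B = B} {A = A} B-reachable A-reachable m m∈M =
    s , m , m∘s≈id , retraction∘section≈id⇒inverse m∘s≈id (proj₂ (A-reachable B s s∈M))
    where
      s : PCMorphism F I B A
      s = proj₁ (B-reachable A m m∈M)

      m∘s≈id : hom m ∘ hom s ≈ id
      m∘s≈id = proj₂ (B-reachable A m m∈M)

      s∈M : M (hom s)
      s∈M = M-cancelˡ m∈M (M-resp-≈ (≈.sym m∘s≈id) (iso⇒M id-isIso))

module ConstructionProperties {o ℓ e p : Level} {𝒞 : Category o ℓ e}
                              (FS : FactorizationSystem 𝒞 p) (F : Endofunctor 𝒞)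
                              (I : Category.Obj 𝒞) (CP : CountableCoproducts 𝒞)
                              {Cc : PointedCoalgebra F I} (K : Construction FS F I CP Cc) where
  open Category 𝒞
  open CategoryProperties 𝒞
  open FactorizationSystem FS
  open FactorizationProperties FS
  open Endofunctor F
  open CountableCoproducts CP
  open CoproductProperties CP
  open CoalgebraProperties FS F
  open PointedCoalgebra Cc using () renaming (point to i)
  open PCMorphism
  open Construction K
  open HomReasoning

  e-in : ∀ k → Cs k ⇒ R
  e-in k = e' ∘ inj Cs k

  γ-in : ∀ k → γ ∘ inj Cs k ≈ F₁ (inj Cs (suc k)) ∘ cs k
  γ-in k = ≈.trans (pullʳ (commute _ k)) (pullˡ (commute _ k))

  r-e-in : ∀ k → r ∘ e-in k ≈ F₁ (e-in (suc k)) ∘ cs k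
  r-e-in k = begin
    r ∘ (e' ∘ inj Cs k)                         ≈⟨ pullˡ r-e ⟩
    (F₁ e' ∘ γ) ∘ inj Cs k                      ≈⟨ pullʳ (γ-in k) ⟩
    F₁ e' ∘ (F₁ (inj Cs (suc k)) ∘ cs k)        ≈⟨ pullˡ (≈.sym homomorphism) ⟩
    F₁ (e' ∘ inj Cs (suc k)) ∘ cs k             ∎

  m'-e-in : ∀ k → m' ∘ e-in k ≈ m k
  m'-e-in k = ≈.trans (pullˡ (≈.sym copair-factor)) (commute m k)

  e-in∈M : ∀ k → M (e-in k)
  e-in∈M k = M-cancelˡ m'∈M (M-resp-≈ (≈.sym (m'-e-in k)) (m∈M k))

  m'-hom : PCMorphism F I coalgebra Cc
  m'-hom = record
    { hom       = m'
    ; commutes  = ≈.sym r-m'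
    ; preserves = begin
        m' ∘ (e' ∘ (inj Cs 0 ∘ i'))  ≈⟨ refl⟩∘⟨ assoc ⟨
        m' ∘ (e-in 0 ∘ i')           ≈⟨ pullˡ (m'-e-in 0) ⟩
        m 0 ∘ i'                     ≈⟨ i-factor ⟨
        i                            ∎
    }

  module Lifting {D : PointedCoalgebra F I} (h : PCMorphism F I D coalgebra)
                 (h∈M : M (hom h)) where
    open PointedCoalgebra D renaming (carrier to D₀; structure to δ; point to iD)

    Lift : ℕ → Set (ℓ ⊔ e)
    Lift k = Σ[ d ∈ Cs k ⇒ D₀ ] (hom h ∘ d ≈ e-in k)

    lift-zero : Σ[ d ∈ Cs 0 ⇒ D₀ ] (d ∘ i' ≈ iD × hom h ∘ d ≈ e-in 0)
    lift-zero = fill-in i'∈E h∈M (begin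
      e-in 0 ∘ i'             ≈⟨ assoc ⟩
      e' ∘ (inj Cs 0 ∘ i')    ≈⟨ preserves h ⟨
      hom h ∘ iD              ∎)

    lift-suc : ∀ k → ((d , _) : Lift k) →
               Σ[ d' ∈ Cs (suc k) ⇒ D₀ ] (F₁ d' ∘ cs k ≈ δ ∘ d × hom h ∘ d' ≈ e-in (suc k))
    lift-suc k (d , h∘d≈e-in) =
      cs-precise k (δ ∘ d) (e-in (suc k)) (hom h) (e-in∈M (suc k)) h∈M (begin
        F₁ (e-in (suc k)) ∘ cs k  ≈⟨ r-e-in k ⟨
        r ∘ e-in k                ≈⟨ refl⟩∘⟨ h∘d≈e-in ⟨
        r ∘ (hom h ∘ d)           ≈⟨ pullˡ (commutes h) ⟩
        (F₁ (hom h) ∘ δ) ∘ d      ≈⟨ assoc ⟩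
        F₁ (hom h) ∘ (δ ∘ d)      ∎)

    lift : ∀ k → Lift k
    lift zero    = proj₁ lift-zero , proj₂ (proj₂ lift-zero)
    lift (suc k) = proj₁ (lift-suc k (lift k)) , proj₂ (proj₂ (lift-suc k (lift k)))

    d : ∀ k → Cs k ⇒ D₀
    d k = proj₁ (lift k)

    d-structure : ∀ k → F₁ (d (suc k)) ∘ cs k ≈ δ ∘ d k
    d-structure k = proj₁ (proj₂ (lift-suc k (lift k)))

    h∘[d]≈e' : hom h ∘ [ d ] ≈ e'
    h∘[d]≈e' = ∐-ext λ k → ≈.trans (pullʳ (commute d k)) (proj₂ (lift k))

    [d]-isCoalgebraHom : IsCoalgebraHom γ δ [ d ]
    [d]-isCoalgebraHom = ∐-ext λ k → begin
      (δ ∘ [ d ]) ∘ inj Cs k                  ≈⟨ pullʳ (commute d k) ⟩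
      δ ∘ d k                                 ≈⟨ d-structure k ⟨
      F₁ (d (suc k)) ∘ cs k                   ≈⟨ F-resp-≈ (commute d (suc k)) ⟩∘⟨refl ⟨
      F₁ ([ d ] ∘ inj Cs (suc k)) ∘ cs k      ≈⟨ pullˡ (≈.sym homomorphism) ⟨
      F₁ [ d ] ∘ (F₁ (inj Cs (suc k)) ∘ cs k) ≈⟨ pullʳ (γ-in k) ⟨
      (F₁ [ d ] ∘ γ) ∘ inj Cs k               ∎

    section : Σ[ s ∈ R ⇒ D₀ ] (s ∘ e' ≈ [ d ] × hom h ∘ s ≈ id)
    section = fill-in e'∈E h∈M (≈.trans identityˡ (≈.sym h∘[d]≈e'))

    s : R ⇒ D₀
    s = proj₁ section

    section-hom : PreservesM FS F → PCMorphism F I coalgebra D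
    section-hom preservesM = record
      { hom       = s
      ; commutes  = diagonal-isCoalgebraHom e'∈E (preservesM h∈M) r-e (commutes h)
                      [d]-isCoalgebraHom IsCoalgebraHom-id
                      (proj₁ (proj₂ section)) (proj₂ (proj₂ section))
      ; preserves = begin
          s ∘ (e' ∘ (inj Cs 0 ∘ i'))  ≈⟨ pullˡ (proj₁ (proj₂ section)) ⟩
          [ d ] ∘ (inj Cs 0 ∘ i')     ≈⟨ pullˡ (commute d 0) ⟩
          d 0 ∘ i'                    ≈⟨ proj₁ (proj₂ lift-zero) ⟩
          iD                          ∎
      }

  coalgebra-reachable : PreservesM FS F → Reachable FS F I coalgebra
  coalgebra-reachable preservesM D h h∈M = section-hom preservesM , proj₂ (proj₂ section)
    where open Lifting h h∈M

corollary4p14 : ∀ {o ℓ e p} (𝒞 : Category o ℓ e) (FS : FactorizationSystem 𝒞 p)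
                  (F : Endofunctor 𝒞) (I : Category.Obj 𝒞) (CP : CountableCoproducts 𝒞) →
                  PreservesM FS F → AdmitsPreciseFactorizations FS F →
                  (C : PointedCoalgebra F I) (K : Construction FS F I CP C) →
                  Reachable FS F I C ⇔ PCIsomorphic F I C (Construction.coalgebra K)
-- The precise factorizations are part of the data K.
corollary4p14 𝒞 FS F I CP preservesM _ C K = mk⇔
  (λ C-reachable → M-morphism-of-Reachable⇒PCIsomorphic C-reachable R-reachable m'-hom m'∈M)
  (λ C≅R → Reachable-resp-PCIsomorphic C≅R R-reachable)
  where
    open ReachabilityProperties FS F I
    open ConstructionProperties FS F I CP K
    open Construction K using (m'∈M)
    R-reachable : Reachable FS F I (Construction.coalgebra K)
    R-reachable = coalgebra-reachable preservesM
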